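{- Let $G_1,G_2,G_3$ be finite groups and let $H\le G_1\times G_2\times G_3$ be a strict almost-direct product of $G_1,G_2,G_3$. Then $H$ is commutative.
   Context: For finite groups $G_1,G_2,G_3$, a subgroup $H\le G_1\times G_2\times G_3$ is an almost-direct product of $G_1,G_2,G_3$ if: (i) $H\ne G_1\times G_2\times G_3$; (ii) for all $\pi_2\in G_2,\pi_3\in G_3$ there is $\pi_1\in G_1$ with $(\pi_1,\pi_2,\pi_3)\in H$; (iii) for all $\pi_1\in G_1,\pi_3\in G_3$ there is $\pi_2\in G_2$ with $(\pi_1,\pi_2,\pi_3)\in H$; (iv) for all $\pi_1\in G_1,\pi_2\in G_2$ there is $\pi_3\in G_3$ with $(\pi_1,\pi_2,\pi_3)\in H$. It is strict if moreover the element $\pi_1$ in (ii), $\pi_2$ in (iii) and $\pi_3$ in (iv) is uniquely determined. -}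

module Defs where

open import Level using (Level; _⊔_; suc)
open import Algebra.Bundles using (Group)
open import Data.Nat using (ℕ)
open import Data.Fin using (Fin)
open import Data.Product using (Σ; ∃; _×_; _,_)
open import Relation.Nullary using (¬_)

Finite : ∀ {c ℓ} → Group c ℓ → Set (c ⊔ ℓ)
Finite G = Σ ℕ λ n → Σ (Fin n → Carrier) λ f → ∀ x → ∃ λ i → f i ≈ x
  where open Group G

module _ {c₁ ℓ₁ c₂ ℓ₂ c₃ ℓ₃ : Level}
         (G₁ : Group c₁ ℓ₁) (G₂ : Group c₂ ℓ₂) (G₃ : Group c₃ ℓ₃) where
  private
    module G₁ = Group G₁
    module G₂ = Group G₂
    module G₃ = Group G₃

  record Subgroup³ (p : Level) : Set (c₁ ⊔ ℓ₁ ⊔ c₂ ⊔ ℓ₂ ⊔ c₃ ⊔ ℓ₃ ⊔ suc p) where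
    field
      mem : G₁.Carrier → G₂.Carrier → G₃.Carrier → Set p
      ∈-resp-≈ : ∀ {a a' b b' c c'} → a G₁.≈ a' → b G₂.≈ b' → c G₃.≈ c' →
                 mem a b c → mem a' b' c'
      ε-∈      : mem G₁.ε G₂.ε G₃.ε
      ∙-∈      : ∀ {a b c a' b' c'} → mem a b c → mem a' b' c' →
                 mem (a G₁.∙ a') (b G₂.∙ b') (c G₃.∙ c')
      ⁻¹-∈     : ∀ {a b c} → mem a b c →
                 mem (a G₁.⁻¹) (b G₂.⁻¹) (c G₃.⁻¹)

  module _ {p : Level} (H : Subgroup³ p) where
    open Subgroup³ H

    IsAlmostDirect : Set (c₁ ⊔ c₂ ⊔ c₃ ⊔ p)
    IsAlmostDirect =
      (¬ (∀ a b c → mem a b c))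
      × (∀ b c → ∃ λ a → mem a b c)
      × (∀ a c → ∃ λ b → mem a b c)
      × (∀ a b → ∃ λ c → mem a b c)

    IsStrictAlmostDirect : Set (c₁ ⊔ ℓ₁ ⊔ c₂ ⊔ ℓ₂ ⊔ c₃ ⊔ ℓ₃ ⊔ p)
    IsStrictAlmostDirect =
      IsAlmostDirect
      × (∀ {a a' b c} → mem a b c → mem a' b c → a G₁.≈ a')
      × (∀ {a b b' c} → mem a b c → mem a b' c → b G₂.≈ b')
      × (∀ {a b c c'} → mem a b c → mem a b c' → c G₃.≈ c')

    IsCommutative : Set (c₁ ⊔ ℓ₁ ⊔ c₂ ⊔ ℓ₂ ⊔ c₃ ⊔ ℓ₃ ⊔ p)
    IsCommutative = ∀ {a b c a' b' c'} → mem a b c → mem a' b' c' →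
      ((a G₁.∙ a') G₁.≈ (a' G₁.∙ a))
      × ((b G₂.∙ b') G₂.≈ (b' G₂.∙ b))
      × ((c G₃.∙ c') G₃.≈ (c' G₃.∙ c))

-- Proof idea: given a, a' ∈ G₁, complete them to (a, b, 1) and (a', 1, c) in H.
-- Both products of these elements have the coordinates (·, b, c), so strictness
-- forces a a' = a' a.  Hence every factor is abelian (by symmetry of the
-- hypotheses under rotating the coordinates), and so is H.
module Submission where

open import Defs
open import Level using (Level)
open import Algebra.Bundles using (Group)
open import Algebra.Definitions using (Commutative)
open import Data.Product using (∃; _,_)

module _ {c₁ ℓ₁ c₂ ℓ₂ c₃ ℓ₃ : Level}
         {G₁ : Group c₁ ℓ₁} {G₂ : Group c₂ ℓ₂} {G₃ : Group c₃ ℓ₃} where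
  private
    module G₁ = Group G₁
    module G₂ = Group G₂
    module G₃ = Group G₃

  rotate : ∀ {p} → Subgroup³ G₁ G₂ G₃ p → Subgroup³ G₂ G₃ G₁ p
  rotate H = record
    { mem      = λ b c a → mem a b c
    ; ∈-resp-≈ = λ b≈ c≈ a≈ → ∈-resp-≈ a≈ b≈ c≈
    ; ε-∈      = ε-∈
    ; ∙-∈      = ∙-∈
    ; ⁻¹-∈     = ⁻¹-∈
    }
    where open Subgroup³ H

  module _ {p : Level} (H : Subgroup³ G₁ G₂ G₃ p) where
    open Subgroup³ H

    first-commutative :
      (∀ a → ∃ λ b → mem a b G₃.ε) →
      (∀ a → ∃ λ c → mem a G₂.ε c) →
      (∀ {a a' b c} → mem a b c → mem a' b c → a G₁.≈ a') →
      Commutative G₁._≈_ G₁._∙_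
    first-commutative complete₂ complete₃ unique₁ a a'
      with complete₂ a | complete₃ a'
    ... | b , abε | c , a'εc = unique₁
      (∈-resp-≈ G₁.refl (G₂.identityʳ b) (G₃.identityˡ c) (∙-∈ abε a'εc))
      (∈-resp-≈ G₁.refl (G₂.identityˡ b) (G₃.identityʳ c) (∙-∈ a'εc abε))

    commutative-factors⇒IsCommutative :
      Commutative G₁._≈_ G₁._∙_ →
      Commutative G₂._≈_ G₂._∙_ →
      Commutative G₃._≈_ G₃._∙_ →
      IsCommutative G₁ G₂ G₃ H
    commutative-factors⇒IsCommutative comm₁ comm₂ comm₃ {a} {b} {c} {a'} {b'} {c'} _ _ =
      comm₁ a a' , comm₂ b b' , comm₃ c c'

lemma3 : ∀ {c₁ ℓ₁ c₂ ℓ₂ c₃ ℓ₃ p : Level}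
    (G₁ : Group c₁ ℓ₁) (G₂ : Group c₂ ℓ₂) (G₃ : Group c₃ ℓ₃) →
    Finite G₁ → Finite G₂ → Finite G₃ →
    (H : Subgroup³ G₁ G₂ G₃ p) →
    IsStrictAlmostDirect G₁ G₂ G₃ H →
    IsCommutative G₁ G₂ G₃ H
lemma3 G₁ G₂ G₃ _ _ _ H ((_ , ii , iii , iv) , unique₁ , unique₂ , unique₃) =
  commutative-factors⇒IsCommutative H
    (first-commutative H (λ a → iii a G₃.ε) (λ a → iv a G₂.ε) unique₁)
    (first-commutative (rotate H) (λ b → iv G₁.ε b) (λ b → ii b G₃.ε) unique₂)
    (first-commutative (rotate (rotate H)) (λ c → ii G₂.ε c) (λ c → iii G₁.ε c) unique₃)
  where
  module G₁ = Group G₁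
  module G₂ = Group G₂
  module G₃ = Group G₃
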